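{- In an oriented graph $\vec G$, if $u,v$ are twins, then both $u$ and $v$ belong to every MAG-set of $\vec G$.
   Context: Two distinct vertices $u,v$ of an oriented graph are twins if $N^+(u)=N^+(v)$ and $N^-(u)=N^-(v)$, where $N^+$, $N^-$ denote out- and in-neighbourhoods. Two distinct vertices $x,y$ monitor an arc $a$ if $a$ lies on every shortest directed path from $x$ to $y$, or on every shortest directed path from $y$ to $x$. A monitoring arc-geodetic set (MAG-set) is a vertex set $M$ such that every arc is monitored by some pair of distinct vertices of $M$. Throughout, oriented graphs are assumed connected. -}

module Defs where

open import Data.Nat using (ℕ; zero; suc; _≤_)
open import Data.Fin using (Fin)
open import Data.Fin.Subset using (Subset; _∈_)
open import Data.Product using (Σ; ∃; _×_; _,_)
open import Data.Sum using (_⊎_)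
open import Relation.Nullary using (¬_)
open import Relation.Binary.PropositionalEquality using (_≡_; _≢_)
open import Function.Bundles using (_⇔_)

record OrientedGraph (n : ℕ) : Set₁ where
  field
    Arc   : Fin n → Fin n → Set
    loopless : ∀ v → ¬ Arc v v
    antisym  : ∀ u v → Arc u v → ¬ Arc v u

module _ {n : ℕ} (G : OrientedGraph n) where
  open OrientedGraph G

  data Walk : Fin n → Fin n → ℕ → Set where
    here : ∀ {x} → Walk x x zero
    step : ∀ {x z y k} → Arc x z → Walk z y k → Walk x y (suc k)

  data UWalk : Fin n → Fin n → Set where
    uhere : ∀ {x} → UWalk x x
    ustep : ∀ {x z y} → (Arc x z ⊎ Arc z x) → UWalk z y → UWalk x y

  Connected : Set
  Connected = ∀ x y → UWalk x y

  data OnWalk (a b : Fin n) : ∀ {x y k} → Walk x y k → Set where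
    this  : ∀ {y k} (e : Arc a b) (w : Walk b y k) → OnWalk a b (step e w)
    later : ∀ {x z y k} (e : Arc x z) {w : Walk z y k} → OnWalk a b w → OnWalk a b (step e w)

  -- A shortest directed path from x to y: a walk of minimum length
  -- (such a walk is automatically a path).
  Shortest : ∀ {x y k} → Walk x y k → Set
  Shortest {x} {y} {k} _ = ∀ k' → Walk x y k' → k ≤ k'

  OnAllShortest : Fin n → Fin n → Fin n → Fin n → Set
  OnAllShortest x y a b =
    (∃ λ k → Walk x y k) ×
    (∀ k (w : Walk x y k) → Shortest w → OnWalk a b w)

  Monitors : Fin n → Fin n → Fin n → Fin n → Set
  Monitors x y a b = x ≢ y × (OnAllShortest x y a b ⊎ OnAllShortest y x a b)

  IsMAGSet : Subset n → Set
  IsMAGSet M = ∀ a b → Arc a b →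
    Σ (Fin n) λ x → Σ (Fin n) λ y → x ∈ M × y ∈ M × Monitors x y a b

  Twins : Fin n → Fin n → Set
  Twins u v = u ≢ v × (∀ w → (Arc u w ⇔ Arc v w) × (Arc w u ⇔ Arc w v))

{-# OPTIONS --safe #-}
-- Replacing u by its twin v sends arcs to arcs, so it turns any walk between
-- two vertices other than u into a walk of the same length that avoids u.
-- Hence an arc at u lies on no shortest path between two vertices other
-- than u, and can only be monitored by a pair containing u. By connectivity
-- u has an incident arc, and a MAG-set must monitor it.
module Submission where

open import Defs
open import Data.Nat using (ℕ; _≤_; _<_; _≤?_)
open import Data.Nat.Properties using (≰⇒>)
open import Data.Nat.Induction using (<-rec)
open import Data.Fin using (Fin; _≟_)
open import Data.Fin.Subset using (Subset; _∈_)
open import Data.Product using (Σ; ∃; ∃₂; _×_; _,_; proj₁; proj₂)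
open import Data.Sum using (_⊎_; inj₁; inj₂; [_,_])
open import Data.Empty using (⊥-elim)
open import Relation.Nullary using (¬_; yes; no)
open import Relation.Binary.PropositionalEquality
  using (_≡_; _≢_; refl; sym; subst₂)
open import Function.Bundles using (Equivalence)
import Function.Properties.Equivalence as ⇔

¬¬-least : (P : ℕ → Set) {k : ℕ} → P k → ¬ ¬ ∃ λ m → P m × (∀ j → P j → m ≤ j)
¬¬-least P {k} = <-rec (λ k → P k → ¬ ¬ ∃ λ m → P m × (∀ j → P j → m ≤ j)) go k
  where
  go : ∀ k → (∀ {j} → j < k → P j → ¬ ¬ ∃ λ m → P m × (∀ j → P j → m ≤ j)) →
       P k → ¬ ¬ ∃ λ m → P m × (∀ j → P j → m ≤ j)
  go k smaller pk ¬least = ¬least (k , pk , least)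
    where
    least : ∀ j → P j → k ≤ j
    least j pj with k ≤? j
    ... | yes k≤j = k≤j
    ... | no k≰j  = ⊥-elim (smaller (≰⇒> k≰j) pj ¬least)

module _ {n : ℕ} (G : OrientedGraph n) where
  open OrientedGraph G

  ¬¬-shortest : ∀ {x y k} → Walk G x y k → ¬ ¬ ∃ λ m → Σ (Walk G x y m) (Shortest G)
  ¬¬-shortest {x} {y} w = ¬¬-least (Walk G x y) w

  Twins-sym : ∀ {u v} → Twins G u v → Twins G v u
  Twins-sym (u≢v , same) =
    (λ v≡u → u≢v (sym v≡u)) , λ w → ⇔.sym (proj₁ (same w)) , ⇔.sym (proj₂ (same w))

  connected⇒incident-arc : Connected G → ∀ {u v} → u ≢ v →
                           ∃₂ λ a b → Arc a b × (a ≡ u ⊎ b ≡ u)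
  connected⇒incident-arc conn {u} {v} u≢v with conn u v
  ... | uhere                  = ⊥-elim (u≢v refl)
  ... | ustep {z = w} (inj₁ e) _ = u , w , e , inj₁ refl
  ... | ustep {z = w} (inj₂ e) _ = w , u , e , inj₂ refl

  module _ (h : Fin n → Fin n) (hom : ∀ {a b} → Arc a b → Arc (h a) (h b)) where

    mapWalk : ∀ {x y k} → Walk G x y k → Walk G (h x) (h y) k
    mapWalk here       = here
    mapWalk (step e w) = step (hom e) (mapWalk w)

    OnWalk-mapWalk : ∀ {a b x y k} (w : Walk G x y k) → OnWalk G a b (mapWalk w) →
                     (∃ λ a′ → h a′ ≡ a) × (∃ λ b′ → h b′ ≡ b)
    OnWalk-mapWalk (step {x = a′} {z = b′} e w) (this _ _) = (a′ , refl) , (b′ , refl)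
    OnWalk-mapWalk (step e w) (later _ on) = OnWalk-mapWalk w on

  module _ {u v : Fin n} (twins : Twins G u v) where

    replace : Fin n → Fin n
    replace z with z ≟ u
    ... | yes _ = v
    ... | no _  = z

    replace-arc : ∀ {a b} → Arc a b → Arc (replace a) (replace b)
    replace-arc {a} {b} e with a ≟ u | b ≟ u
    ... | yes refl | yes refl = ⊥-elim (loopless u e)
    ... | yes refl | no _     = Equivalence.to (proj₁ (proj₂ twins b)) e
    ... | no _     | yes refl = Equivalence.to (proj₂ (proj₂ twins a)) e
    ... | no _     | no _     = e

    replace-≢ : ∀ a → replace a ≢ u
    replace-≢ a with a ≟ u
    ... | yes _   = λ v≡u → proj₁ twins (sym v≡u)
    ... | no a≢u  = a≢u

    replace-fix : ∀ {a} → a ≢ u → replace a ≡ a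
    replace-fix {a} a≢u with a ≟ u
    ... | yes a≡u = ⊥-elim (a≢u a≡u)
    ... | no _    = refl

    walk-avoiding-twin : ∀ {x y k} → x ≢ u → y ≢ u → Walk G x y k →
      Σ (Walk G x y k) λ w → ∀ {a b} → OnWalk G a b w → a ≢ u × b ≢ u
    walk-avoiding-twin {x} {y} {k} x≢u y≢u w =
      subst₂ (λ s t → Σ (Walk G s t k) λ w → ∀ {a b} → OnWalk G a b w → a ≢ u × b ≢ u)
             (replace-fix x≢u) (replace-fix y≢u)
             (mapWalk replace replace-arc w , avoids)
      where
      avoids : ∀ {a b} → OnWalk G a b (mapWalk replace replace-arc w) → a ≢ u × b ≢ u
      avoids on with OnWalk-mapWalk replace replace-arc w on
      ... | (a′ , refl) , (b′ , refl) = replace-≢ a′ , replace-≢ b′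

    -- Arcs are not decidable, so a shortest walk exists only up to double
    -- negation; that suffices, as the goal is ⊥.
    incident-arc-¬OnAllShortest : ∀ {x y a b} → x ≢ u → y ≢ u → (a ≡ u ⊎ b ≡ u) →
                                  ¬ OnAllShortest G x y a b
    incident-arc-¬OnAllShortest x≢u y≢u incident ((_ , w₀) , onAll) =
      ¬¬-shortest w₀ λ (k , w , shortest) →
        let (w′ , avoids) = walk-avoiding-twin x≢u y≢u w
            (a≢u , b≢u)   = avoids (onAll k w′ shortest)
        in [ a≢u , b≢u ] incident

    incident-arc-monitor : ∀ {x y a b} → (a ≡ u ⊎ b ≡ u) → Monitors G x y a b →
                           x ≡ u ⊎ y ≡ u
    incident-arc-monitor {x} {y} incident (_ , onAll) with x ≟ u | y ≟ u
    ... | yes x≡u | _       = inj₁ x≡u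
    ... | no _    | yes y≡u = inj₂ y≡u
    ... | no x≢u  | no y≢u  = ⊥-elim ([ incident-arc-¬OnAllShortest x≢u y≢u incident
                                      , incident-arc-¬OnAllShortest y≢u x≢u incident ] onAll)

    twin-∈-MAGSet : Connected G → ∀ M → IsMAGSet G M → u ∈ M
    twin-∈-MAGSet conn M mag
      with a , b , e , incident ← connected⇒incident-arc conn (proj₁ twins)
      with x , y , x∈M , y∈M , monitors ← mag a b e
      with incident-arc-monitor incident monitors
    ... | inj₁ refl = x∈M
    ... | inj₂ refl = y∈M

proposition3 : ∀ {n} (G : OrientedGraph n) → Connected G →
    ∀ (u v : Fin n) → Twins G u v →
    ∀ (M : Subset n) → IsMAGSet G M → u ∈ M × v ∈ M
proposition3 G conn u v twins M mag =
  twin-∈-MAGSet G twins conn M mag , twin-∈-MAGSet G (Twins-sym G twins) conn M mag
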